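{- Let $\mathcal F\subseteq\mathcal P([n])$ be $\mathcal N$-saturated, let $\mathcal G$ be a component of $\mathcal F$, and let $M\in\mathcal F$ satisfy $B\subseteq M\subseteq A$ for every minimal element $B$ and every maximal element $A$ of $\mathcal G$, with $M$ minimal under inclusion among elements of $\mathcal F$ with this property. Suppose $i\in[n]$, $i\notin M$ and $M\cup\{i\}\notin\mathcal F$. If $M\cup\{i\}$ is a maximal element of some induced copy of $\mathcal N$ in $\mathcal F\cup\{M\cup\{i\}\}$, then there exists an induced copy of $\mathcal N$ in $\mathcal F\cup\{M\cup\{i\}\}$ in which $M\cup\{i\}$ is the maximal element comparable to both minimal elements and $M$ is one of the minimal elements. Moreover, the number of $i\in[n]$ with $i\notin M$, $M\cup\{i\}\notin\mathcal F$, and $M\cup\{i\}$ a maximal element of some induced copy of $\mathcal N$ in $\mathcal F\cup\{M\cup\{i\}\}$ is at most $|\mathcal F|-2$.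
   Context: $[n]=\{1,\dots,n\}$, $\mathcal P([n])$ its power set ordered by inclusion. The poset $\mathcal N$ has four elements $a,b,c,d$ with $a<c$, $b<c$, $b<d$ and no other comparabilities. A family contains an induced copy of $\mathcal N$ if it contains distinct sets $P,Q,R,S$ with $P\subset R$, $Q\subset R$, $Q\subset S$ and each of the pairs $\{P,Q\},\{P,S\},\{R,S\}$ incomparable; $P,Q$ are the minimal and $R,S$ the maximal elements of the copy, and $R$ is the maximal element comparable to both minimal elements. $\mathcal F$ is $\mathcal N$-saturated if it contains no induced copy of $\mathcal N$ but $\mathcal F\cup\{X\}$ contains one for every $X\in\mathcal P([n])\setminus\mathcal F$. A component of $\mathcal F$ is the vertex set of a connected component of the Hasse diagram of $(\mathcal F\setminus\{\emptyset,[n]\},\subseteq)$ viewed as an undirected graph; its minimal and maximal elements are taken with respect to inclusion within the component. (Such an $M$ exists for every component.) -}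

module Defs where

open import Data.Nat using (ℕ)
open import Data.Fin using (Fin)
open import Data.Fin.Subset using (Subset; _⊆_; _⊂_; ⊥; ⊤)
open import Data.List using (List; _∷_)
open import Data.List.Membership.Propositional using () renaming (_∈_ to _∈ₗ_; _∉_ to _∉ₗ_)
open import Data.Product using (_×_; Σ; ∃)
open import Data.Sum using (_⊎_)
open import Relation.Nullary using (¬_)
open import Relation.Binary.PropositionalEquality using (_≡_; _≢_)

-- A family of subsets of [n] is a duplicate-free list of subsets (uniqueness is
-- imposed in the statement); membership in the family is list membership.
Family : ℕ → Set
Family n = List (Subset n)

module _ {n : ℕ} where

  Incomp : Subset n → Subset n → Set
  Incomp X Y = ¬ (X ⊆ Y) × ¬ (Y ⊆ X)

  -- P,Q,R,S form an induced copy of N (P,Q minimal; R,S maximal;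
  -- R is the maximal element comparable to both minimal elements)
  IsN : Subset n → Subset n → Subset n → Subset n → Set
  IsN P Q R S =
    (P ≢ Q) × (P ≢ R) × (P ≢ S) × (Q ≢ R) × (Q ≢ S) × (R ≢ S) ×
    (P ⊂ R) × (Q ⊂ R) × (Q ⊂ S) ×
    Incomp P Q × Incomp P S × Incomp R S

  NCopyIn : Family n → Subset n → Subset n → Subset n → Subset n → Set
  NCopyIn F P Q R S = (P ∈ₗ F) × (Q ∈ₗ F) × (R ∈ₗ F) × (S ∈ₗ F) × IsN P Q R S

  ContainsN : Family n → Set
  ContainsN F = Σ (Subset n) λ P → Σ (Subset n) λ Q → Σ (Subset n) λ R →
                Σ (Subset n) λ S → NCopyIn F P Q R S

  -- F ∪ {X} is represented by the list X ∷ F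
  Saturated : Family n → Set
  Saturated F = ¬ ContainsN F × ((X : Subset n) → X ∉ₗ F → ContainsN (X ∷ F))

  MaxOfSomeN : Family n → Subset n → Set
  MaxOfSomeN F X = Σ (Subset n) λ P → Σ (Subset n) λ Q → Σ (Subset n) λ S →
                   NCopyIn F P Q X S ⊎ NCopyIn F P Q S X

  -- vertices of the Hasse diagram: F ∖ {∅, [n]}
  Inner : Family n → Subset n → Set
  Inner F X = (X ∈ₗ F) × (X ≢ ⊥) × (X ≢ ⊤)

  Covers : Family n → Subset n → Subset n → Set
  Covers F X Y = Inner F X × Inner F Y × (X ⊂ Y) ×
                 ((Z : Subset n) → Inner F Z → ¬ ((X ⊂ Z) × (Z ⊂ Y)))

  data Reach (F : Family n) : Subset n → Subset n → Set where
    here : ∀ {X} → Inner F X → Reach F X X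
    up   : ∀ {X Y Z} → Reach F X Y → Covers F Y Z → Reach F X Z
    down : ∀ {X Y Z} → Reach F X Y → Covers F Z Y → Reach F X Z

  -- the component of F containing the vertex v (v is assumed Inner F v)
  InComp : Family n → Subset n → Subset n → Set
  InComp F v X = Reach F v X

  MinOfComp : Family n → Subset n → Subset n → Set
  MinOfComp F v B = InComp F v B × ((Y : Subset n) → InComp F v Y → ¬ (Y ⊂ B))

  MaxOfComp : Family n → Subset n → Subset n → Set
  MaxOfComp F v A = InComp F v A × ((Y : Subset n) → InComp F v Y → ¬ (A ⊂ Y))

  Between : Family n → Subset n → Subset n → Set
  Between F v M = (B A : Subset n) → MinOfComp F v B → MaxOfComp F v A → (B ⊆ M) × (M ⊆ A)

  IsM : Family n → Subset n → Subset n → Set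
  IsM F v M = (M ∈ₗ F) × Between F v M ×
              ((M' : Subset n) → M' ∈ₗ F → Between F v M' → ¬ (M' ⊂ M))

-- Every member Y of the component is comparable with M. Otherwise, for a minimal B ⊄ Y the sets
-- B, B′, M, Y (B′ minimal below Y) would form an induced N, and likewise every member of F strictly
-- between ∅ and M lies below Y, or it would be a smaller choice for M. So the union U of these
-- members is comparable with every set of the component; adding U to F creates no N, hence U ∈ F by
-- saturation, and U ⊂ M contradicts the minimality of M.
-- Given a copy of N with M ∪ {i} maximal, a case split on whether i lies in its minimal elements
-- either replaces one of them by M, or yields an N inside F, or a set of the component incomparable
-- with M. In the resulting copy the other minimal element W satisfies W ∖ M = {i}, so distinct i
-- give distinct W, all in F and different from ∅ and [n].
module Submission where

open import Defs
open import Data.Nat using (ℕ; suc; _≤_; _∸_; z≤n; s≤s)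
open import Data.Nat.Properties using (<⇒≱)
open import Data.Bool using () renaming (_≟_ to _≟ᵇ_)
open import Data.Vec.Properties using (≡-dec)
open import Data.Fin using (Fin)
open import Data.Fin.Subset using (Subset; _∈_; _∉_; _⊆_; _⊈_; _⊂_; _∪_; ⁅_⁆; ⊥; ⊤; ∣_∣; ⋃)
open import Data.Fin.Subset.Properties
  using (_∈?_; _⊆?_; _⊂?_; ⊆-refl; ⊆-reflexive; ⊆-trans; ⊆-antisym; ⊥⊆; ⊆⊤; ⊂-irref; ⊂-trans;
         p⊂q⇒∣p∣<∣q∣; p⊆p∪q; q⊆p∪q; x∈p∪q⁻; x∈⁅x⁆; x∈⁅y⁆⇒x≡y)
open import Data.Fin.Subset.Induction using (Acc; acc; ⊂-wellFounded)
open import Data.List using (List; []; _∷_; length; filter)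
open import Data.List.Properties using (length-removeAt′)
open import Data.List.Extrema.Nat using (argmax; argmin; argmax-all; argmin-all; f[xs]≤f[argmax]; f[argmin]≤f[xs])
open import Data.List.Relation.Unary.Any using (here; there; any?; satisfied; index; _─_)
open import Data.List.Relation.Unary.All as All using (All; []; _∷_; lookup)
open import Data.List.Relation.Unary.All.Properties using (all-filter)
open import Data.List.Relation.Unary.AllPairs using ([]; _∷_)
open import Data.List.Relation.Unary.Unique.Propositional using (Unique)
open import Data.List.Membership.Propositional using (lose) renaming (_∈_ to _∈ₗ_; _∉_ to _∉ₗ_)
open import Data.List.Membership.Propositional.Properties using (∈-filter⁺)
open import Data.Product using (_×_; Σ; ∃; _,_; proj₁; proj₂)
open import Data.Sum using (_⊎_; inj₁; inj₂; [_,_])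
open import Data.Empty using (⊥-elim) renaming (⊥ to ⊥₀)
open import Relation.Nullary using (¬_; Dec; yes; no)
open import Relation.Nullary.Decidable using (_×-dec_; ¬?)
open import Relation.Unary using (Decidable)
open import Function using (id)
open import Relation.Binary.Definitions using (DecidableEquality)
open import Relation.Binary.PropositionalEquality using (_≡_; _≢_; refl; sym; trans; cong; subst; ≢-sym)

private
  variable
    n : ℕ
    P Q R S T W X Y Z : Subset n

Comparable : Subset n → Subset n → Set
Comparable X Y = X ⊆ Y ⊎ Y ⊆ X

_≟ₛ_ : DecidableEquality (Subset n)
_≟ₛ_ = ≡-dec _≟ᵇ_

_∈ₗ?_ : (X : Subset n) (xs : List (Subset n)) → Dec (X ∈ₗ xs)
X ∈ₗ? xs = any? (X ≟ₛ_) xs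

⊆∧≢⇒⊂ : X ⊆ Y → X ≢ Y → X ⊂ Y
⊆∧≢⇒⊂ {X = X} {Y} X⊆Y X≢Y with X ⊂? Y
... | yes X⊂Y = X⊂Y
... | no X⊄Y = ⊥-elim (X≢Y (⊆-antisym X⊆Y Y⊆X))
  where
  Y⊆X : Y ⊆ X
  Y⊆X {x} x∈Y with x ∈? X
  ... | yes x∈X = x∈X
  ... | no x∉X = ⊥-elim (X⊄Y (X⊆Y , x , x∈Y , x∉X))

⊆⇒≡⊎⊂ : X ⊆ Y → X ≡ Y ⊎ X ⊂ Y
⊆⇒≡⊎⊂ {X = X} {Y} X⊆Y with X ≟ₛ Y
... | yes X≡Y = inj₁ X≡Y
... | no X≢Y = inj₂ (⊆∧≢⇒⊂ X⊆Y X≢Y)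

⊆∧⊈⇒⊂ : X ⊆ Y → X ⊆ Z → Y ⊈ Z → X ⊂ Y
⊆∧⊈⇒⊂ X⊆Y X⊆Z Y⊈Z = ⊆∧≢⇒⊂ X⊆Y (λ { refl → Y⊈Z X⊆Z })

⊂⇒⊉ : X ⊂ Y → Y ⊈ X
⊂⇒⊉ (_ , x , x∈Y , x∉X) Y⊆X = x∉X (Y⊆X x∈Y)

Incomp-sym : Incomp X Y → Incomp Y X
Incomp-sym (X⊈Y , Y⊈X) = Y⊈X , X⊈Y

Incomp⇒¬Comparable : Incomp X Y → ¬ Comparable X Y
Incomp⇒¬Comparable (X⊈Y , _) (inj₁ X⊆Y) = X⊈Y X⊆Y
Incomp⇒¬Comparable (_ , Y⊈X) (inj₂ Y⊆X) = Y⊈X Y⊆X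

Incomp⇒Inner : {F : Family n} → X ∈ₗ F → Incomp X Y → Inner F X
Incomp⇒Inner X∈F (X⊈Y , Y⊈X) = X∈F , (λ { refl → X⊈Y ⊥⊆ }) , (λ { refl → Y⊈X ⊆⊤ })

isN : P ⊂ R → Q ⊂ R → Q ⊂ S → Incomp P Q → Incomp P S → Incomp R S → IsN P Q R S
isN P⊂R Q⊂R Q⊂S P∥Q P∥S R∥S =
  Incomp⇒≢ P∥Q , ⊂⇒≢ P⊂R , Incomp⇒≢ P∥S , ⊂⇒≢ Q⊂R , ⊂⇒≢ Q⊂S , Incomp⇒≢ R∥S ,
  P⊂R , Q⊂R , Q⊂S , P∥Q , P∥S , R∥S
  where
  ⊂⇒≢ : X ⊂ Y → X ≢ Y
  ⊂⇒≢ X⊂Y X≡Y = ⊂-irref X≡Y X⊂Y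
  Incomp⇒≢ : Incomp X Y → X ≢ Y
  Incomp⇒≢ (X⊈Y , _) refl = X⊈Y ⊆-refl

module _ {n : ℕ} {P : Subset n → Set} (P? : Decidable P)
         {xs : List (Subset n)} (P⇒∈ : ∀ {X} → P X → X ∈ₗ xs) where

  ⊂-maximal : P Y → ∃ λ Z → P Z × (∀ {X} → P X → ¬ Z ⊂ X)
  ⊂-maximal {Y} pY = largest , argmax-all ∣_∣ pY (all-filter P? xs) , λ pX largest⊂X →
    <⇒≱ (p⊂q⇒∣p∣<∣q∣ largest⊂X) (lookup (f[xs]≤f[argmax] {f = ∣_∣} Y (filter P? xs)) (∈-filter⁺ P? (P⇒∈ pX) pX))
    where
    largest : Subset n
    largest = argmax ∣_∣ Y (filter P? xs)

  ⊂-minimal : P Y → ∃ λ Z → P Z × (∀ {X} → P X → ¬ X ⊂ Z)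
  ⊂-minimal {Y} pY = smallest , argmin-all ∣_∣ pY (all-filter P? xs) , λ pX X⊂smallest →
    <⇒≱ (p⊂q⇒∣p∣<∣q∣ X⊂smallest) (lookup (f[argmin]≤f[xs] {f = ∣_∣} Y (filter P? xs)) (∈-filter⁺ P? (P⇒∈ pX) pX))
    where
    smallest : Subset n
    smallest = argmin ∣_∣ Y (filter P? xs)

⊆⋃ : {xs : List (Subset n)} → X ∈ₗ xs → X ⊆ ⋃ xs
⊆⋃ {xs = Y ∷ ys} (here refl) = p⊆p∪q (⋃ ys)
⊆⋃ {xs = Y ∷ ys} (there X∈ys) = ⊆-trans (⊆⋃ X∈ys) (q⊆p∪q Y (⋃ ys))

⋃-least : {xs : List (Subset n)} → All (_⊆ X) xs → ⋃ xs ⊆ X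
⋃-least [] = ⊥⊆
⋃-least {xs = Y ∷ ys} (Y⊆X ∷ ys⊆X) x∈ = [ Y⊆X , ⋃-least ys⊆X ] (x∈p∪q⁻ Y (⋃ ys) x∈)

module _ {A : Set} where

  ∈-∷⁻ : {x y : A} {xs : List A} → y ∈ₗ x ∷ xs → y ≢ x → y ∈ₗ xs
  ∈-∷⁻ (here y≡x) y≢x = ⊥-elim (y≢x y≡x)
  ∈-∷⁻ (there y∈xs) _ = y∈xs

  ∈-─ : {x y : A} {xs : List A} (x∈xs : x ∈ₗ xs) → y ∈ₗ xs → y ≢ x → y ∈ₗ (xs ─ x∈xs)
  ∈-─ (here refl) (here refl) y≢x = ⊥-elim (y≢x refl)
  ∈-─ (here refl) (there y∈xs) _ = y∈xs
  ∈-─ (there x∈xs) (here refl) _ = here refl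
  ∈-─ (there x∈xs) (there y∈xs) y≢x = there (∈-─ x∈xs y∈xs y≢x)

module _ {A B : Set} where

  length-≤-by-injection : {R : A → B → Set} → (∀ {a a′ b} → R a b → R a′ b → a′ ≡ a) →
                          {as : List A} {bs : List B} →
                          Unique as → All (λ a → ∃ λ b → b ∈ₗ bs × R a b) as → length as ≤ length bs
  length-≤-by-injection inj [] [] = z≤n
  length-≤-by-injection {R = R} inj {a ∷ as} {bs} (a∉as ∷ distinct) ((b , b∈bs , Rab) ∷ images) =
    subst (suc (length as) ≤_) (sym (length-removeAt′ bs (index b∈bs)))
      (s≤s (length-≤-by-injection inj distinct (All.zipWith avoid (a∉as , images))))
    where
    avoid : ∀ {a′} → a ≢ a′ × (∃ λ b′ → b′ ∈ₗ bs × R a′ b′) → ∃ λ b′ → b′ ∈ₗ (bs ─ b∈bs) × R a′ b′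
    avoid (a≢a′ , b′ , b′∈bs , Ra′b′) = b′ , ∈-─ b∈bs b′∈bs (λ { refl → a≢a′ (sym (inj Rab Ra′b′)) }) , Ra′b′

module HasseDiagram {n : ℕ} (F : Family n) where

  Inner? : Decidable (Inner F)
  Inner? X = (X ∈ₗ? F) ×-dec (¬? (X ≟ₛ ⊥) ×-dec ¬? (X ≟ₛ ⊤))

  Reach-inner : Reach F X Y → Inner F Y
  Reach-inner (here iY) = iY
  Reach-inner (up _ (_ , iY , _)) = iY
  Reach-inner (down _ (iY , _)) = iY

  Reach-trans : Reach F X Y → Reach F Y Z → Reach F X Z
  Reach-trans r (here _) = r
  Reach-trans r (up s c) = up (Reach-trans r s) c
  Reach-trans r (down s c) = down (Reach-trans r s) c

  Reach-sym : Reach F X Y → Reach F Y X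
  Reach-sym (here iX) = here iX
  Reach-sym (up r c@(_ , iZ , _)) = Reach-trans (down (here iZ) c) (Reach-sym r)
  Reach-sym (down r c@(iZ , _)) = Reach-trans (up (here iZ) c) (Reach-sym r)

  ⊂⇒Reach : Inner F W → Inner F Z → W ⊂ Z → Reach F W Z
  ⊂⇒Reach {W = W} iW iZ W⊂Z = go (⊂-wellFounded _) iZ W⊂Z
    where
    Between? : (Z : Subset n) → Decidable (λ Y → Inner F Y × W ⊂ Y × Y ⊂ Z)
    Between? Z Y = Inner? Y ×-dec (W ⊂? Y ×-dec Y ⊂? Z)

    go : Acc _⊂_ Z → Inner F Z → W ⊂ Z → Reach F W Z
    go {Z} (acc below) iZ W⊂Z with any? (Between? Z) F
    ... | no ∄Y = up (here iW) (iW , iZ , W⊂Z , λ Y iY W⊂Y⊂Z → ∄Y (lose (proj₁ iY) (iY , W⊂Y⊂Z)))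
    ... | yes ∃Y with ⊂-maximal (Between? Z) (λ b → proj₁ (proj₁ b)) (proj₂ (satisfied ∃Y))
    ...   | Y , (iY , W⊂Y , Y⊂Z) , maximal =
      up (go (below Y⊂Z) iY W⊂Y)
         (iY , iZ , Y⊂Z , λ T iT (Y⊂T , T⊂Z) → maximal (iT , ⊂-trans W⊂Y Y⊂T , T⊂Z) Y⊂T)

  Comparable⇒Reach : Inner F W → Inner F Z → Comparable W Z → Reach F W Z
  Comparable⇒Reach iW iZ (inj₁ W⊆Z) with ⊆⇒≡⊎⊂ W⊆Z
  ... | inj₁ refl = here iW
  ... | inj₂ W⊂Z = ⊂⇒Reach iW iZ W⊂Z
  Comparable⇒Reach iW iZ (inj₂ Z⊆W) with ⊆⇒≡⊎⊂ Z⊆W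
  ... | inj₁ refl = here iW
  ... | inj₂ Z⊂W = Reach-sym (⊂⇒Reach iZ iW Z⊂W)

ComparabilityClosed : Family n → Subset n → Set
ComparabilityClosed F U =
  ∀ {T T′} → Inner F T → Inner F T′ → Comparable T T′ → Comparable U T → Comparable U T′

-- Each element of an induced N is linked to an element incomparable with it by two comparabilities.
closed-extension-N-free : {F : Family n} {U : Subset n} →
  ¬ ContainsN F → ComparabilityClosed F U → ¬ ContainsN (U ∷ F)
closed-extension-N-free {F = F} {U} N-free closed
  (P , Q , R , S , P∈ , Q∈ , R∈ , S∈ , N@(P≢Q , P≢R , _ , Q≢R , _ , R≢S , P⊂R , Q⊂R , Q⊂S , P∥Q , _ , R∥S)) =
  go P∈ Q∈ R∈ S∈
  where
  Q-inner : Q ∈ₗ F → Inner F Q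
  Q-inner Q∈F = Incomp⇒Inner Q∈F (Incomp-sym P∥Q)
  R-inner : R ∈ₗ F → Inner F R
  R-inner R∈F = Incomp⇒Inner R∈F R∥S
  S-inner : S ∈ₗ F → Inner F S
  S-inner S∈F = Incomp⇒Inner S∈F (Incomp-sym R∥S)

  go : P ∈ₗ U ∷ F → Q ∈ₗ U ∷ F → R ∈ₗ U ∷ F → S ∈ₗ U ∷ F → ⊥₀
  go (here refl) _ _ _ =
    Incomp⇒¬Comparable P∥Q (closed (R-inner (∈-∷⁻ R∈ (≢-sym P≢R))) (Q-inner (∈-∷⁻ Q∈ (≢-sym P≢Q)))
                                   (inj₂ (proj₁ Q⊂R)) (inj₁ (proj₁ P⊂R)))
  go (there P∈F) (here refl) _ _ =
    Incomp⇒¬Comparable (Incomp-sym P∥Q) (closed (R-inner (∈-∷⁻ R∈ (≢-sym Q≢R))) (Incomp⇒Inner P∈F P∥Q)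
                                                (inj₂ (proj₁ P⊂R)) (inj₁ (proj₁ Q⊂R)))
  go (there _) (there Q∈F) (here refl) _ =
    Incomp⇒¬Comparable R∥S (closed (Q-inner Q∈F) (S-inner (∈-∷⁻ S∈ (≢-sym R≢S)))
                                   (inj₁ (proj₁ Q⊂S)) (inj₂ (proj₁ Q⊂R)))
  go (there _) (there Q∈F) (there R∈F) (here refl) =
    Incomp⇒¬Comparable (Incomp-sym R∥S) (closed (Q-inner Q∈F) (R-inner R∈F)
                                                (inj₁ (proj₁ Q⊂R)) (inj₂ (proj₁ Q⊂S)))
  go (there P∈F) (there Q∈F) (there R∈F) (there S∈F) = N-free (P , Q , R , S , P∈F , Q∈F , R∈F , S∈F , N)

module _ {F : Family n} (sat : Saturated F) where

  closed⇒∈ : {U : Subset n} → ComparabilityClosed F U → U ∈ₗ F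
  closed⇒∈ {U} closed with U ∈ₗ? F
  ... | yes U∈F = U∈F
  ... | no U∉F = ⊥-elim (closed-extension-N-free (proj₁ sat) closed (proj₂ sat U U∉F))

  ⊥∈ : ⊥ ∈ₗ F
  ⊥∈ = closed⇒∈ (λ _ _ _ _ → inj₁ ⊥⊆)

  ⊤∈ : ⊤ ∈ₗ F
  ⊤∈ = closed⇒∈ (λ _ _ _ _ → inj₂ ⊆⊤)

_∖_≡⁅_⁆ : Subset n → Subset n → Fin n → Set
W ∖ M ≡⁅ i ⁆ = i ∈ W × i ∉ M × W ⊆ M ∪ ⁅ i ⁆

∖≡⁅⁆-injective : {M : Subset n} {i j : Fin n} → W ∖ M ≡⁅ i ⁆ → W ∖ M ≡⁅ j ⁆ → j ≡ i
∖≡⁅⁆-injective {M = M} {i} (_ , _ , W⊆M∪i) (j∈W , j∉M , _) =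
  [ (λ j∈M → ⊥-elim (j∉M j∈M)) , x∈⁅y⁆⇒x≡y i ] (x∈p∪q⁻ M ⁅ i ⁆ (W⊆M∪i j∈W))

module Component {n : ℕ} (F : Family n) (sat : Saturated F) (v : Subset n) (v-inner : Inner F v)
                 (M : Subset n) (isM : IsM F v M) where

  open HasseDiagram F

  private
    variable
      A B : Subset n

  N-free : ¬ ContainsN F
  N-free = proj₁ sat

  M∈F : M ∈ₗ F
  M∈F = proj₁ isM

  M-between : Between F v M
  M-between = proj₁ (proj₂ isM)

  M-least : (W : Subset n) → W ∈ₗ F → Between F v W → ¬ W ⊂ M
  M-least = proj₂ (proj₂ isM)

  ∈F : InComp F v Y → Y ∈ₗ F
  ∈F Y∈G = proj₁ (Reach-inner Y∈G)

  InComp-closed : InComp F v Y → Inner F Z → Comparable Y Z → InComp F v Z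
  InComp-closed Y∈G iZ Y~Z = Reach-trans Y∈G (Comparable⇒Reach (Reach-inner Y∈G) iZ Y~Z)

  min-below : InComp F v Y → ∃ λ B → MinOfComp F v B × B ⊆ Y
  min-below {Y} Y∈G with ⊂-minimal (λ B → Inner? B ×-dec B ⊆? Y) (λ b → proj₁ (proj₁ b)) (Reach-inner Y∈G , ⊆-refl)
  ... | B , (iB , B⊆Y) , minimal =
    B , (InComp-closed Y∈G iB (inj₂ B⊆Y) , λ Z Z∈G Z⊂B → minimal (Reach-inner Z∈G , ⊆-trans (proj₁ Z⊂B) B⊆Y) Z⊂B) , B⊆Y

  max-above : InComp F v Y → ∃ λ A → MaxOfComp F v A × Y ⊆ A
  max-above {Y} Y∈G with ⊂-maximal (λ A → Inner? A ×-dec Y ⊆? A) (λ a → proj₁ (proj₁ a)) (Reach-inner Y∈G , ⊆-refl)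
  ... | A , (iA , Y⊆A) , maximal =
    A , (InComp-closed Y∈G iA (inj₁ Y⊆A) , λ Z Z∈G A⊂Z → maximal (Reach-inner Z∈G , ⊆-trans Y⊆A (proj₁ A⊂Z)) A⊂Z) , Y⊆A

  min-eq : MinOfComp F v B → InComp F v Z → Z ⊆ B → Z ≡ B
  min-eq (_ , minimal) Z∈G Z⊆B with ⊆⇒≡⊎⊂ Z⊆B
  ... | inj₁ Z≡B = Z≡B
  ... | inj₂ Z⊂B = ⊥-elim (minimal _ Z∈G Z⊂B)

  min⊆M : MinOfComp F v B → B ⊆ M
  min⊆M mB = proj₁ (M-between _ _ mB (proj₁ (proj₂ (max-above (here v-inner)))))

  M⊆max : MaxOfComp F v A → M ⊆ A
  M⊆max mA = proj₂ (M-between _ _ (proj₁ (proj₂ (min-below (here v-inner)))) mA)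

  M-inner : Inner F M
  M-inner with min-below (here v-inner) | max-above (here v-inner)
  ... | B , mB , _ | A , mA , _ =
    M∈F , (λ { refl → proj₁ (proj₂ (Reach-inner (proj₁ mB))) (⊆-antisym (min⊆M mB) ⊥⊆) })
        , (λ { refl → proj₂ (proj₂ (Reach-inner (proj₁ mA))) (⊆-antisym ⊆⊤ (M⊆max mA)) })

  M∈G : InComp F v M
  M∈G with min-below (here v-inner)
  ... | _ , mB , _ = InComp-closed (proj₁ mB) M-inner (inj₁ (min⊆M mB))

  min⊆incomparable : InComp F v Y → Incomp Y M → MinOfComp F v B → B ⊆ Y
  min⊆incomparable {Y} {B} Y∈G (Y⊈M , M⊈Y) mB with B ⊆? Y | min-below Y∈G
  ... | yes B⊆Y | _ = B⊆Y
  ... | no B⊈Y | B′ , mB′ , B′⊆Y =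
    ⊥-elim (N-free (B , B′ , M , Y , ∈F (proj₁ mB) , ∈F (proj₁ mB′) , M∈F , ∈F Y∈G ,
      isN (⊆∧≢⇒⊂ (min⊆M mB) (λ { refl → B′⊈B (min⊆M mB′) }))
          (⊆∧⊈⇒⊂ (min⊆M mB′) B′⊆Y M⊈Y) (⊆∧⊈⇒⊂ B′⊆Y (min⊆M mB′) Y⊈M)
          ((λ B⊆B′ → B⊈Y (⊆-trans B⊆B′ B′⊆Y)) , B′⊈B)
          (B⊈Y , λ Y⊆B → B′⊈B (⊆-trans B′⊆Y Y⊆B))
          (M⊈Y , Y⊈M)))
    where
    B′⊈B : B′ ⊈ B
    B′⊈B B′⊆B = B⊈Y (subst (_⊆ Y) (min-eq mB (proj₁ mB′) B′⊆B) B′⊆Y)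

  Lower : Subset n → Set
  Lower W = Inner F W × W ⊂ M

  Lower? : Decidable Lower
  Lower? W = Inner? W ×-dec W ⊂? M

  ⋃lower : Subset n
  ⋃lower = ⋃ (filter Lower? F)

  lower⊆⋃lower : Lower W → W ⊆ ⋃lower
  lower⊆⋃lower lW = ⊆⋃ (∈-filter⁺ Lower? (proj₁ (proj₁ lW)) lW)

  ⋃lower-least : (∀ {W} → Lower W → W ⊆ Z) → ⋃lower ⊆ Z
  ⋃lower-least lower⊆Z = ⋃-least (All.map lower⊆Z (all-filter Lower? F))

  ⋃lower⊆M : ⋃lower ⊆ M
  ⋃lower⊆M = ⋃lower-least (λ lW → proj₁ (proj₂ lW))

  lower⊆incomparable : InComp F v Y → Incomp Y M → Lower W → W ⊆ Y
  lower⊆incomparable {Y} {W} Y∈G Y∥M@(Y⊈M , M⊈Y) (iW , W⊂M) with W ⊆? Y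
  ... | yes W⊆Y = W⊆Y
  ... | no W⊈Y = ⊥-elim (M-least W (proj₁ iW) W-between W⊂M)
    where
    W∈G : InComp F v W
    W∈G = InComp-closed M∈G iW (inj₂ (proj₁ W⊂M))

    min⊆W : MinOfComp F v B → B ⊆ W
    min⊆W {B} mB with B ⊆? W
    ... | yes B⊆W = B⊆W
    ... | no B⊈W =
      ⊥-elim (N-free (W , B , M , Y , proj₁ iW , ∈F (proj₁ mB) , M∈F , ∈F Y∈G ,
        isN W⊂M (⊆∧⊈⇒⊂ (min⊆M mB) B⊆Y M⊈Y) (⊆∧⊈⇒⊂ B⊆Y (min⊆M mB) Y⊈M)
            ((λ W⊆B → B⊈W (⊆-reflexive (sym (min-eq mB W∈G W⊆B)))) , B⊈W)
            (W⊈Y , λ Y⊆W → Y⊈M (⊆-trans Y⊆W (proj₁ W⊂M)))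
            (M⊈Y , Y⊈M)))
      where
      B⊆Y : B ⊆ Y
      B⊆Y = min⊆incomparable Y∈G Y∥M mB

    W-between : Between F v W
    W-between _ _ mB mA = min⊆W mB , ⊆-trans (proj₁ W⊂M) (M⊆max mA)

  ⋃lower-comparable : InComp F v T → Comparable ⋃lower T
  ⋃lower-comparable {T} T∈G with T ⊆? M | M ⊆? T
  ... | yes T⊆M | _ with ⊆⇒≡⊎⊂ T⊆M
  ...   | inj₁ refl = inj₁ ⋃lower⊆M
  ...   | inj₂ T⊂M = inj₂ (lower⊆⋃lower (Reach-inner T∈G , T⊂M))
  ⋃lower-comparable T∈G | no _ | yes M⊆T = inj₁ (⊆-trans ⋃lower⊆M M⊆T)
  ⋃lower-comparable T∈G | no T⊈M | no M⊈T = inj₁ (⋃lower-least (lower⊆incomparable T∈G (T⊈M , M⊈T)))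

  comparable-to-M : InComp F v Y → ¬ Incomp Y M
  comparable-to-M {Y} Y∈G Y∥M@(_ , M⊈Y) with min-below Y∈G
  ... | B₀ , mB₀ , _ = M-least ⋃lower (closed⇒∈ sat closed) ⋃lower-between ⋃lower⊂M
    where
    ⋃lower⊂M : ⋃lower ⊂ M
    ⋃lower⊂M = ⊆∧⊈⇒⊂ ⋃lower⊆M (⋃lower-least (lower⊆incomparable Y∈G Y∥M)) M⊈Y

    min-lower : MinOfComp F v B → Lower B
    min-lower mB = Reach-inner (proj₁ mB) , ⊆∧⊈⇒⊂ (min⊆M mB) (min⊆incomparable Y∈G Y∥M mB) M⊈Y

    ⋃lower-between : Between F v ⋃lower
    ⋃lower-between _ _ mB mA = lower⊆⋃lower (min-lower mB) , ⊆-trans ⋃lower⊆M (M⊆max mA)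

    comparable-in-G : Inner F T → Comparable ⋃lower T → InComp F v T
    comparable-in-G iT (inj₁ ⋃lower⊆T) =
      InComp-closed (proj₁ mB₀) iT (inj₁ (⊆-trans (lower⊆⋃lower (min-lower mB₀)) ⋃lower⊆T))
    comparable-in-G iT (inj₂ T⊆⋃lower) = InComp-closed M∈G iT (inj₂ (⊆-trans T⊆⋃lower ⋃lower⊆M))

    closed : ComparabilityClosed F ⋃lower
    closed iT iT′ T~T′ ⋃lower~T = ⋃lower-comparable (InComp-closed (comparable-in-G iT ⋃lower~T) iT′ T~T′)

  ⊤≢⊥ : ⊤ ≢ ⊥
  ⊤≢⊥ ⊤≡⊥ = proj₁ (proj₂ v-inner) (⊆-antisym (subst (v ⊆_) ⊤≡⊥ ⊆⊤) ⊥⊆)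

  F∖⊥⊤ : List (Subset n)
  F∖⊥⊤ = (F ─ ⊥∈ sat) ─ ∈-─ (⊥∈ sat) (⊤∈ sat) ⊤≢⊥

  length-F∖⊥⊤ : length F∖⊥⊤ ≡ length F ∸ 2
  length-F∖⊥⊤ =
    cong (_∸ 2) (sym (trans (length-removeAt′ F _) (cong suc (length-removeAt′ (F ─ ⊥∈ sat) _))))

  inner⇒∈F∖⊥⊤ : Inner F W → W ∈ₗ F∖⊥⊤
  inner⇒∈F∖⊥⊤ (W∈F , W≢⊥ , W≢⊤) = ∈-─ _ (∈-─ (⊥∈ sat) W∈F W≢⊥) W≢⊤

  module Adjoin {i : Fin n} (i∉M : i ∉ M) where

    X⁺ : Subset n
    X⁺ = M ∪ ⁅ i ⁆

    M⊆X⁺ : M ⊆ X⁺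
    M⊆X⁺ = p⊆p∪q ⁅ i ⁆

    M⊂X⁺ : M ⊂ X⁺
    M⊂X⁺ = M⊆X⁺ , i , q⊆p∪q M ⁅ i ⁆ (x∈⁅x⁆ i) , i∉M

    ⊆X⁺∧∉⇒⊆M : Y ⊆ X⁺ → i ∉ Y → Y ⊆ M
    ⊆X⁺∧∉⇒⊆M {Y} Y⊆X⁺ i∉Y x∈Y =
      [ id , (λ x∈i → ⊥-elim (i∉Y (subst (_∈ Y) (x∈⁅y⁆⇒x≡y i x∈i) x∈Y))) ] (x∈p∪q⁻ M ⁅ i ⁆ (Y⊆X⁺ x∈Y))

    ⊇M∧∈⇒⊇X⁺ : M ⊆ Y → i ∈ Y → X⁺ ⊆ Y
    ⊇M∧∈⇒⊇X⁺ {Y} M⊆Y i∈Y x∈X⁺ =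
      [ M⊆Y , (λ x∈i → subst (_∈ Y) (sym (x∈⁅y⁆⇒x≡y i x∈i)) i∈Y) ] (x∈p∪q⁻ M ⁅ i ⁆ x∈X⁺)

    ThroughM : Set
    ThroughM = Σ (Subset n) λ P → Σ (Subset n) λ S →
               NCopyIn (X⁺ ∷ F) M P X⁺ S ⊎ NCopyIn (X⁺ ∷ F) P M X⁺ S

    copy-M-Q-X⁺ : Q ∈ₗ F → Q ⊂ X⁺ → i ∈ Q → S ∈ₗ F → Q ⊂ S → Incomp X⁺ S → NCopyIn (X⁺ ∷ F) M Q X⁺ S
    copy-M-Q-X⁺ Q∈F Q⊂X⁺ i∈Q S∈F Q⊂S X⁺∥S@(X⁺⊈S , S⊈X⁺) =
      there M∈F , there Q∈F , here refl , there S∈F ,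
      isN M⊂X⁺ Q⊂X⁺ Q⊂S
          ((λ M⊆Q → ⊂⇒⊉ Q⊂X⁺ (⊇M∧∈⇒⊇X⁺ M⊆Q i∈Q)) , λ Q⊆M → i∉M (Q⊆M i∈Q))
          ((λ M⊆S → X⁺⊈S (⊇M∧∈⇒⊇X⁺ M⊆S (proj₁ Q⊂S i∈Q))) , λ S⊆M → S⊈X⁺ (⊆-trans S⊆M M⊆X⁺))
          X⁺∥S

    X⁺-as-R : P ∈ₗ F → Q ∈ₗ F → S ∈ₗ F → IsN P Q X⁺ S → ThroughM
    X⁺-as-R {P} {Q} {S} P∈F Q∈F S∈F (_ , _ , _ , _ , _ , _ , P⊂X⁺ , Q⊂X⁺ , Q⊂S , P∥Q , P∥S , X⁺∥S)
      with i ∈? Q | i ∈? P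
    ... | yes i∈Q | _ = Q , S , inj₁ (copy-M-Q-X⁺ Q∈F Q⊂X⁺ i∈Q S∈F Q⊂S X⁺∥S)
    ... | no i∉Q | no i∉P =
      ⊥-elim (N-free (P , Q , M , S , P∈F , Q∈F , M∈F , S∈F ,
        isN (⊆∧≢⇒⊂ P⊆M (λ { refl → proj₂ P∥Q Q⊆M })) (⊆∧≢⇒⊂ Q⊆M (λ { refl → proj₁ P∥Q P⊆M })) Q⊂S P∥Q P∥S
            ((λ M⊆S → proj₁ P∥S (⊆-trans P⊆M M⊆S)) , λ S⊆M → proj₂ X⁺∥S (⊆-trans S⊆M M⊆X⁺))))
      where
      P⊆M : P ⊆ M
      P⊆M = ⊆X⁺∧∉⇒⊆M (proj₁ P⊂X⁺) i∉P
      Q⊆M : Q ⊆ M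
      Q⊆M = ⊆X⁺∧∉⇒⊆M (proj₁ Q⊂X⁺) i∉Q
    ... | no i∉Q | yes i∈P with M ⊆? S
    ...   | yes M⊆S =
      P , S , inj₂ (there P∈F , there M∈F , here refl , there S∈F ,
        isN P⊂X⁺ M⊂X⁺ (⊆∧⊈⇒⊂ M⊆S M⊆X⁺ (proj₂ X⁺∥S))
            ((λ P⊆M → i∉M (P⊆M i∈P)) , λ M⊆P → ⊂⇒⊉ P⊂X⁺ (⊇M∧∈⇒⊇X⁺ M⊆P i∈P))
            P∥S X⁺∥S)
    ...   | no M⊈S = ⊥-elim (comparable-to-M S∈G ((λ S⊆M → proj₂ X⁺∥S (⊆-trans S⊆M M⊆X⁺)) , M⊈S))
      where
      Q∈G : InComp F v Q
      Q∈G = InComp-closed M∈G (Incomp⇒Inner Q∈F (Incomp-sym P∥Q)) (inj₂ (⊆X⁺∧∉⇒⊆M (proj₁ Q⊂X⁺) i∉Q))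
      S∈G : InComp F v S
      S∈G = InComp-closed Q∈G (Incomp⇒Inner S∈F (Incomp-sym X⁺∥S)) (inj₁ (proj₁ Q⊂S))

    X⁺-as-S : P ∈ₗ F → Q ∈ₗ F → R ∈ₗ F → IsN P Q R X⁺ → ThroughM
    X⁺-as-S {P} {Q} {R} P∈F Q∈F R∈F (_ , _ , _ , _ , _ , _ , P⊂R , Q⊂R , Q⊂X⁺ , P∥Q , P∥X⁺ , R∥X⁺)
      with i ∈? Q
    ... | yes i∈Q = Q , R , inj₁ (copy-M-Q-X⁺ Q∈F Q⊂X⁺ i∈Q R∈F Q⊂R (Incomp-sym R∥X⁺))
    ... | no i∉Q with M ⊆? R
    ...   | no M⊈R =
      ⊥-elim (N-free (P , Q , R , M , P∈F , Q∈F , R∈F , M∈F ,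
        isN P⊂R Q⊂R (⊆∧⊈⇒⊂ Q⊆M (proj₁ Q⊂R) M⊈R) P∥Q
            ((λ P⊆M → proj₁ P∥X⁺ (⊆-trans P⊆M M⊆X⁺)) , λ M⊆P → M⊈R (⊆-trans M⊆P (proj₁ P⊂R)))
            ((λ R⊆M → proj₁ R∥X⁺ (⊆-trans R⊆M M⊆X⁺)) , M⊈R)))
      where
      Q⊆M : Q ⊆ M
      Q⊆M = ⊆X⁺∧∉⇒⊆M (proj₁ Q⊂X⁺) i∉Q
    ...   | yes M⊆R =
      ⊥-elim (comparable-to-M P∈G ((λ P⊆M → proj₁ P∥X⁺ (⊆-trans P⊆M M⊆X⁺)) , λ M⊆P → proj₂ P∥Q (⊆-trans Q⊆M M⊆P)))
      where
      Q⊆M : Q ⊆ M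
      Q⊆M = ⊆X⁺∧∉⇒⊆M (proj₁ Q⊂X⁺) i∉Q
      R∈G : InComp F v R
      R∈G = InComp-closed M∈G (Incomp⇒Inner R∈F R∥X⁺) (inj₁ M⊆R)
      P∈G : InComp F v P
      P∈G = InComp-closed R∈G (Incomp⇒Inner P∈F P∥Q) (inj₂ (proj₁ P⊂R))

    through-M : MaxOfSomeN (X⁺ ∷ F) X⁺ → ThroughM
    through-M (P , Q , S , inj₁ (P∈ , Q∈ , _ , S∈ , N@(_ , P≢X⁺ , _ , Q≢X⁺ , _ , X⁺≢S , _))) =
      X⁺-as-R (∈-∷⁻ P∈ P≢X⁺) (∈-∷⁻ Q∈ Q≢X⁺) (∈-∷⁻ S∈ (≢-sym X⁺≢S)) N
    through-M (P , Q , R , inj₂ (P∈ , Q∈ , R∈ , _ , N@(_ , _ , P≢X⁺ , _ , Q≢X⁺ , R≢X⁺ , _))) =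
      X⁺-as-S (∈-∷⁻ P∈ P≢X⁺) (∈-∷⁻ Q∈ Q≢X⁺) (∈-∷⁻ R∈ R≢X⁺) N

    incomparable-below-X⁺ : W ∈ₗ F → W ⊂ X⁺ → Incomp W M → W ∈ₗ F∖⊥⊤ × W ∖ M ≡⁅ i ⁆
    incomparable-below-X⁺ {W} W∈F W⊂X⁺ W∥M@(W⊈M , _) with i ∈? W
    ... | yes i∈W = inner⇒∈F∖⊥⊤ (Incomp⇒Inner W∈F W∥M) , i∈W , i∉M , proj₁ W⊂X⁺
    ... | no i∉W = ⊥-elim (W⊈M (⊆X⁺∧∉⇒⊆M (proj₁ W⊂X⁺) i∉W))

    partner : ThroughM → ∃ λ W → W ∈ₗ F∖⊥⊤ × W ∖ M ≡⁅ i ⁆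
    partner (P , _ , inj₁ (_ , P∈ , _ , _ , (_ , _ , _ , P≢X⁺ , _ , _ , _ , P⊂X⁺ , _ , M∥P , _ , _))) =
      P , incomparable-below-X⁺ (∈-∷⁻ P∈ P≢X⁺) P⊂X⁺ (Incomp-sym M∥P)
    partner (P , _ , inj₂ (P∈ , _ , _ , _ , (_ , P≢X⁺ , _ , _ , _ , _ , P⊂X⁺ , _ , _ , P∥M , _ , _))) =
      P , incomparable-below-X⁺ (∈-∷⁻ P∈ P≢X⁺) P⊂X⁺ P∥M

lemma3p3 : (n : ℕ) (F : Family n) → Unique F → Saturated F →
    (v : Subset n) → Inner F v → (M : Subset n) → IsM F v M →
    ((i : Fin n) → i ∉ M → (M ∪ ⁅ i ⁆) ∉ₗ F → MaxOfSomeN ((M ∪ ⁅ i ⁆) ∷ F) (M ∪ ⁅ i ⁆) →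
      Σ (Subset n) λ P → Σ (Subset n) λ S →
        NCopyIn ((M ∪ ⁅ i ⁆) ∷ F) M P (M ∪ ⁅ i ⁆) S ⊎ NCopyIn ((M ∪ ⁅ i ⁆) ∷ F) P M (M ∪ ⁅ i ⁆) S)
    × ((is : List (Fin n)) → Unique is →
      All (λ i → (i ∉ M) × ((M ∪ ⁅ i ⁆) ∉ₗ F) × MaxOfSomeN ((M ∪ ⁅ i ⁆) ∷ F) (M ∪ ⁅ i ⁆)) is →
      length is ≤ length F ∸ 2)
lemma3p3 n F _ sat v v-inner M isM = (λ _ i∉M _ → through-M i∉M) , bound
  where
  open Component F sat v v-inner M isM
  open Adjoin

  bound : (is : List (Fin n)) → Unique is →
          All (λ i → (i ∉ M) × ((M ∪ ⁅ i ⁆) ∉ₗ F) × MaxOfSomeN ((M ∪ ⁅ i ⁆) ∷ F) (M ∪ ⁅ i ⁆)) is →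
          length is ≤ length F ∸ 2
  bound is distinct adjoinable =
    subst (length is ≤_) length-F∖⊥⊤
      (length-≤-by-injection {R = λ i W → W ∖ M ≡⁅ i ⁆} ∖≡⁅⁆-injective distinct
        (All.map (λ { (i∉M , _ , X⁺-max) → partner i∉M (through-M i∉M X⁺-max) }) adjoinable))
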